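{- If the input graph $T=(V,E)$ is a tree, with any threshold function $t:V\to\mathbb{N}_0$, then Algorithm TSS on $(T,t)$ returns an optimal solution, i.e., a target set for $T$ of minimum cardinality among all target sets for $T$.
   Context: $\Gamma(v)$ is the neighborhood of $v$ and $d(v)=|\Gamma(v)|$. $\mathbb{N}_0=\{0,1,2,\ldots\}$. Activation process in a graph $H=(W,F)$ with thresholds $\tau:W\to\mathbb{N}_0$: for $S\subseteq W$, $\mathrm{Active}[S,0]=S$ and for $\ell\ge1$, $\mathrm{Active}[S,\ell]=\mathrm{Active}[S,\ell-1]\cup\{u\in W: |\Gamma(u)\cap \mathrm{Active}[S,\ell-1]|\ge \tau(u)\}$. $S$ is a target set if $\mathrm{Active}[S,\lambda]=W$ for some $\lambda\ge0$. Algorithm TSS on input $(G,t)$ with $G=(V,E)$: set $S=\emptyset$, $U=V$, and for each $v\in V$ set $\delta(v)=d(v)$, $k(v)=t(v)$, $N(v)=\Gamma(v)$. While $U\neq\emptyset$: (Case 1) if some $v\in U$ has $k(v)=0$, select such a $v$ and for each $u\in N(v)$ set $k(u)=\max(k(u)-1,0)$; (Case 2) otherwise, if some $v\in U$ has $\delta(v)<k(v)$, select such a $v$, set $S=S\cup\{v\}$, and for each $u\in N(v)$ set $k(u)=k(u)-1$; (Case 3) otherwise select $v\in\arg\max_{u\in U} \frac{k(u)}{\delta(u)(\delta(u)+1)}$. In every case, then, for each $u\in N(v)$ set $\delta(u)=\delta(u)-1$ and $N(u)=N(u)\setminus\{v\}$, and set $U=U\setminus\{v\}$. When $U=\emptyset$,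 output $S$. (When several vertices qualify for selection, the algorithm picks one of them; the choice rule is not specified.) -}

module Defs where

open import Data.Bool using (Bool; true; false; if_then_else_)
open import Data.Nat using (ℕ; zero; suc; _+_; _*_; _∸_; _≤_; _<_; _≤?_)
open import Data.Fin using (Fin; zero; suc; inject₁; fromℕ)
open import Data.Fin.Subset using (Subset; _∪_; _∩_; ∣_∣; _∈_; ⊤; ⊥)
open import Data.Vec using (Vec; lookup; tabulate; _[_]≔_)
open import Data.Product using (Σ; ∃; _×_; _,_)
open import Relation.Nullary using (¬_)
open import Relation.Nullary.Decidable using (⌊_⌋)
open import Relation.Binary.PropositionalEquality using (_≡_; _≢_)
open import Relation.Binary.Construct.Closure.ReflexiveTransitive using (Star)
open import Function.Definitions using (Injective)

record Graph (n : ℕ) : Set where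
  field
    adj   : Fin n → Fin n → Bool
    sym   : ∀ u v → adj u v ≡ adj v u
    irrefl : ∀ v → adj v v ≡ false

open Graph public

Adj : ∀ {n} → Graph n → Fin n → Fin n → Set
Adj G u v = adj G u v ≡ true

Γ : ∀ {n} → Graph n → Fin n → Subset n
Γ G v = tabulate (adj G v)

deg : ∀ {n} → Graph n → Fin n → ℕ
deg G v = ∣ Γ G v ∣

Connected : ∀ {n} → Graph n → Set
Connected {n} G = (u v : Fin n) → Star (Adj G) u v

IsCycle : ∀ {n} → Graph n → (k : ℕ) → (Fin (suc (suc (suc k))) → Fin n) → Set
IsCycle G k c =
  Injective _≡_ _≡_ c
  × ((i : Fin (suc (suc k))) → Adj G (c (inject₁ i)) (c (suc i)))
  × Adj G (c (fromℕ (suc (suc k)))) (c zero)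

Acyclic : ∀ {n} → Graph n → Set
Acyclic {n} G = (k : ℕ) (c : Fin (suc (suc (suc k))) → Fin n) → ¬ IsCycle G k c

IsTree : ∀ {n} → Graph n → Set
IsTree G = Connected G × Acyclic G

Active : ∀ {n} → Graph n → (Fin n → ℕ) → Subset n → ℕ → Subset n
Active G τ S zero    = S
Active G τ S (suc ℓ) =
  Active G τ S ℓ ∪ tabulate (λ u → ⌊ τ u ≤? ∣ Γ G u ∩ Active G τ S ℓ ∣ ⌋)

IsTargetSet : ∀ {n} → Graph n → (Fin n → ℕ) → Subset n → Set
IsTargetSet G τ S = ∃ λ λ′ → Active G τ S λ′ ≡ ⊤

-- Algorithm TSS, modelled as a nondeterministic transition system

record State (n : ℕ) : Set where
  constructor state
  field
    SS : Subset n
    UU : Subset n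
    δ  : Fin n → ℕ
    κ  : Fin n → ℕ
    NN : Fin n → Subset n

open State public

initState : ∀ {n} → Graph n → (Fin n → ℕ) → State n
initState G t = state ⊥ ⊤ (deg G) t (Γ G)

-- the common update after selecting v (uses N(v) before the update)
removeV : ∀ {n} → State n → Fin n → (Fin n → ℕ) → Subset n → State n
removeV st v k′ S′ = state S′ (UU st [ v ]≔ false)
  (λ u → if lookup (NN st v) u then δ st u ∸ 1 else δ st u)
  k′
  (λ u → if lookup (NN st v) u then NN st u [ v ]≔ false else NN st u)

-- k(u) := max(k(u) - 1, 0) = k(u) ∸ 1 for u ∈ N(v)
decK : ∀ {n} → State n → Fin n → Fin n → ℕ
decK st v u = if lookup (NN st v) u then κ st u ∸ 1 else κ st u

data Step {n : ℕ} (st : State n) : State n → Set where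
  case1 : ∀ v → v ∈ UU st → κ st v ≡ 0 →
          Step st (removeV st v (decK st v) (SS st))
  case2 : ∀ v → (∀ u → u ∈ UU st → κ st u ≢ 0) →
          v ∈ UU st → δ st v < κ st v →
          Step st (removeV st v (decK st v) (SS st [ v ]≔ true))
  -- v maximises k(u) / (δ(u)(δ(u)+1)) over U (compared by cross-multiplication;
  -- in this case every u ∈ U has δ(u) ≥ k(u) ≥ 1, so denominators are positive)
  case3 : ∀ v → (∀ u → u ∈ UU st → κ st u ≢ 0) →
          (∀ u → u ∈ UU st → ¬ (δ st u < κ st u)) →
          v ∈ UU st →
          (∀ u → u ∈ UU st →
             κ st u * (δ st v * suc (δ st v)) ≤ κ st v * (δ st u * suc (δ st u))) →
          Step st (removeV st v (κ st) (SS st))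

-- Runs st S : some execution of the while-loop from state st terminates
-- (U = ∅) and outputs S
data Runs {n : ℕ} : State n → Subset n → Set where
  done : ∀ {st} → UU st ≡ ⊥ → Runs st (SS st)
  step : ∀ {st st′ S} → Step st st′ → Runs st′ S → Runs st S

TSSOutput : ∀ {n} → Graph n → (Fin n → ℕ) → Subset n → Set
TSSOutput G t S = Runs (initState G t) S

-- Write U for the vertices still to be processed and k for the current thresholds,
-- so that what remains is the residual instance (G[U], k). A target set of the
-- residual instance is handled through closure: X is one iff every set that is
-- closed under the activation rule and contains X ∩ U contains all of U.
--
-- Each step shrinks the instance without changing its optimum beyond the vertex
-- it selects. A Case 1 vertex (k = 0) becomes active for free and a Case 2 vertex
-- (δ < k) lies in every target set, so removing either one and lowering its
-- neighbours' thresholds loses nothing. In Case 3 every remaining vertex has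
-- 1 ≤ k ≤ δ; as G[U] is a forest it has a leaf, whose ratio k/(δ(δ+1)) is 1/2, so
-- the maximiser v also has δ(v) = k(v) = 1. Such a v is activated by its only
-- neighbour w, and a target set containing v may trade it for w.

module Submission where

open import Defs hiding (sym)
open import Data.Bool using (Bool; true; false; if_then_else_; _∧_)
open import Data.Bool.Properties using (∧-identityʳ; T-≡)
open import Data.Nat using (ℕ; _≰_; _≤?_; zero; suc; _+_; _*_; _∸_; _≤_; _<_; z≤n; s≤s)
open import Data.Nat.Properties
  using (≤-refl; ≤-reflexive; ≤-trans; ≤-antisym; ≤-pred; n≤1+n; <-irrefl; <⇒≱; ≮⇒≥; ≰⇒>; n≤0⇒n≡0;
         n≢0⇒n>0; m≤n⇒m<n∨m≡n; m≤n⇒∃[o]m+o≡n; m≤m+n; m≤n+m∸n; +-identityʳ; +-comm; +-suc;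
         +-cancelˡ-≡; +-monoˡ-≤; +-monoʳ-≤; *-identityˡ; *-cancelˡ-≤; *-monoˡ-≤; ∸-monoˡ-≤;
         module ≤-Reasoning)
open import Data.Fin using (Fin; zero; suc; toℕ; fromℕ<; fromℕ; inject₁)
open import Data.Fin.Properties
  using (_≟_; any?; pigeonhole; toℕ<n; toℕ-fromℕ<; toℕ-fromℕ; toℕ-inject₁; toℕ-injective)
open import Data.Fin.Subset using (Subset; _∈_; _∉_; _⊆_; ∣_∣; _∩_; ⊤; ⊥; ⁅_⁆; _-_)
open import Data.Fin.Subset.Properties
  using (_∈?_; nonempty?; Empty-unique; ∈⊤; ∉⊥; ⊆⊤; ⊆-antisym; x∈⁅x⁆; x∈⁅y⁆⇒x≡y; x∉⁅y⁆⇒x≢y;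
         x∈p∩q⁺; x∈p∩q⁻; x∈p∪q⁺; x∈p∪q⁻; p⊆p∪q; x∈p∧x≢y⇒x∈p-y; ∩-comm; ∩-identityˡ; ∩-identityʳ;
         ∣p∣≤n; ∣⊥∣≡0; ∣⁅x⁆∣≡1; p⊆q⇒∣p∣≤∣q∣; p⊂q⇒∣p∣<∣q∣; x∈p⇒∣p-x∣<∣p∣)
open import Data.Vec using (_∷_; lookup; tabulate; _[_]≔_; here; there)
open import Data.Vec.Properties
  using ([]≔-minimal; []≔-updates; []=⇒lookup; lookup⇒[]=; lookup∘tabulate; lookup-zipWith)
open import Data.Product using (∃; ∃₂; _×_; _,_; proj₁; proj₂)
open import Data.Sum using (_⊎_; inj₁; inj₂; [_,_])
open import Function using (_∘_; id; Equivalence)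
open import Function.Definitions using (Injective)
open import Relation.Nullary using (¬_; yes; no; ¬?; contradiction)
open import Relation.Nullary.Decidable using (_×-dec_; decidable-stable; toWitness; fromWitness)
open import Relation.Binary.PropositionalEquality
  using (_≡_; _≢_; refl; sym; trans; cong; cong₂; subst; subst₂; module ≡-Reasoning)

private
  variable
    n : ℕ
    p q r : Subset n
    x y u v w : Fin n
    G : Graph n
    U X C : Subset n
    τ τ′ : Fin n → ℕ
    X′ S : Subset n
    st : State n

-- Subsets

x∈p⇒x∈p[y]≔true : ∀ y → x ∈ p → x ∈ p [ y ]≔ true
x∈p⇒x∈p[y]≔true {p = _ ∷ _} zero    here      = here
x∈p⇒x∈p[y]≔true {p = _ ∷ _} zero    (there h) = there h
x∈p⇒x∈p[y]≔true {p = _ ∷ _} (suc y) here      = here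
x∈p⇒x∈p[y]≔true {p = _ ∷ _} (suc y) (there h) = there (x∈p⇒x∈p[y]≔true y h)

x∈p[y]≔true⇒x≡y⊎x∈p : ∀ y → x ∈ p [ y ]≔ true → x ≡ y ⊎ x ∈ p
x∈p[y]≔true⇒x≡y⊎x∈p {p = _ ∷ _} zero    here      = inj₁ refl
x∈p[y]≔true⇒x≡y⊎x∈p {p = _ ∷ _} zero    (there h) = inj₂ (there h)
x∈p[y]≔true⇒x≡y⊎x∈p {p = _ ∷ _} (suc y) here      = inj₂ here
x∈p[y]≔true⇒x≡y⊎x∈p {p = _ ∷ _} (suc y) (there h) with x∈p[y]≔true⇒x≡y⊎x∈p y h
... | inj₁ refl = inj₁ refl
... | inj₂ x∈p  = inj₂ (there x∈p)

p[x]≔false⊆p : ∀ (p : Subset n) x → p [ x ]≔ false ⊆ p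
p[x]≔false⊆p (_ ∷ _) zero    (there h) = there h
p[x]≔false⊆p (_ ∷ _) (suc x) here      = here
p[x]≔false⊆p (_ ∷ p) (suc x) (there h) = there (p[x]≔false⊆p p x h)

x∉p[x]≔false : ∀ (p : Subset n) x → x ∉ p [ x ]≔ false
x∉p[x]≔false (_ ∷ p) (suc x) (there h) = x∉p[x]≔false p x h

x∈p∧x≢y⇒x∈p[y]≔false : x ∈ p → x ≢ y → x ∈ p [ y ]≔ false
x∈p∧x≢y⇒x∈p[y]≔false {p = p} {y = y} x∈p x≢y = []≔-minimal p _ y x≢y x∈p

x∈p[y]≔false⇒x≢y : x ∈ p [ y ]≔ false → x ≢ y
x∈p[y]≔false⇒x≢y {p = p} x∈p′ refl = x∉p[x]≔false p _ x∈p′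

x∈p[y]≔true∧x≢y⇒x∈p : x ∈ p [ y ]≔ true → x ≢ y → x ∈ p
x∈p[y]≔true∧x≢y⇒x∈p {y = y} x∈p′ x≢y with x∈p[y]≔true⇒x≡y⊎x∈p y x∈p′
... | inj₁ x≡y = contradiction x≡y x≢y
... | inj₂ x∈p = x∈p

∣p[x]≔true∣≤1+∣p∣ : ∀ (p : Subset n) x → ∣ p [ x ]≔ true ∣ ≤ suc ∣ p ∣
∣p[x]≔true∣≤1+∣p∣ (true  ∷ p) zero    = n≤1+n _
∣p[x]≔true∣≤1+∣p∣ (false ∷ p) zero    = ≤-refl
∣p[x]≔true∣≤1+∣p∣ (true  ∷ p) (suc x) = s≤s (∣p[x]≔true∣≤1+∣p∣ p x)
∣p[x]≔true∣≤1+∣p∣ (false ∷ p) (suc x) = ∣p[x]≔true∣≤1+∣p∣ p x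

x∈p⇒1+∣p[x]≔false∣≡∣p∣ : ∀ (p : Subset n) x → x ∈ p → suc ∣ p [ x ]≔ false ∣ ≡ ∣ p ∣
x∈p⇒1+∣p[x]≔false∣≡∣p∣ (_ ∷ _) zero    here      = refl
x∈p⇒1+∣p[x]≔false∣≡∣p∣ (true  ∷ p) (suc x) (there h) = cong suc (x∈p⇒1+∣p[x]≔false∣≡∣p∣ p x h)
x∈p⇒1+∣p[x]≔false∣≡∣p∣ (false ∷ p) (suc x) (there h) = x∈p⇒1+∣p[x]≔false∣≡∣p∣ p x h

∣p[x]≔true∣+∣q[x]≔false∣≤∣p∣+∣q∣ : ∀ (p q : Subset n) x → x ∈ q →
                                  ∣ p [ x ]≔ true ∣ + ∣ q [ x ]≔ false ∣ ≤ ∣ p ∣ + ∣ q ∣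
∣p[x]≔true∣+∣q[x]≔false∣≤∣p∣+∣q∣ p q x x∈q = begin
  ∣ p [ x ]≔ true ∣ + ∣ q [ x ]≔ false ∣   ≤⟨ +-monoˡ-≤ _ (∣p[x]≔true∣≤1+∣p∣ p x) ⟩
  suc ∣ p ∣ + ∣ q [ x ]≔ false ∣           ≡⟨ sym (+-suc _ _) ⟩
  ∣ p ∣ + suc ∣ q [ x ]≔ false ∣           ≡⟨ cong (∣ p ∣ +_) (x∈p⇒1+∣p[x]≔false∣≡∣p∣ q x x∈q) ⟩
  ∣ p ∣ + ∣ q ∣                            ∎
  where open ≤-Reasoning

∣p[x]≔false[y]≔true∣≤∣p∣ : ∀ (p : Subset n) x y → x ∈ p →
                           ∣ p [ x ]≔ false [ y ]≔ true ∣ ≤ ∣ p ∣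
∣p[x]≔false[y]≔true∣≤∣p∣ p x y x∈p = ≤-trans (∣p[x]≔true∣≤1+∣p∣ (p [ x ]≔ false) y)
  (≤-reflexive (x∈p⇒1+∣p[x]≔false∣≡∣p∣ p x x∈p))

∩-[]≔false : ∀ (p q : Subset n) x → p ∩ (q [ x ]≔ false) ≡ (p ∩ q) [ x ]≔ false
∩-[]≔false (true  ∷ p) (_ ∷ q) zero    = refl
∩-[]≔false (false ∷ p) (_ ∷ q) zero    = refl
∩-[]≔false (s ∷ p)     (t ∷ q) (suc x) = cong (_ ∷_) (∩-[]≔false p q x)

x∉p⇒p∩q[x]≔b≡p∩q : ∀ (p q : Subset n) {x} b → x ∉ p → p ∩ (q [ x ]≔ b) ≡ p ∩ q
x∉p⇒p∩q[x]≔b≡p∩q (true  ∷ p) (_ ∷ q) {zero}  b x∉p = contradiction here x∉p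
x∉p⇒p∩q[x]≔b≡p∩q (false ∷ p) (_ ∷ q) {zero}  b x∉p = refl
x∉p⇒p∩q[x]≔b≡p∩q (s ∷ p)     (t ∷ q) {suc x} b x∉p =
  cong (_ ∷_) (x∉p⇒p∩q[x]≔b≡p∩q p q b (λ x∈p → x∉p (there x∈p)))

⊆⊎⊈ : ∀ (p q : Subset n) → p ⊆ q ⊎ ∃ λ x → x ∈ p × x ∉ q
⊆⊎⊈ p q with any? (λ x → x ∈? p ×-dec ¬? (x ∈? q))
... | yes (x , x∈p , x∉q) = inj₂ (x , x∈p , x∉q)
... | no ∄x = inj₁ λ {x} x∈p → decidable-stable (x ∈? q) (λ x∉q → ∄x (x , x∈p , x∉q))

x∈p⇒⁅x⁆⊆p : x ∈ p → ⁅ x ⁆ ⊆ p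
x∈p⇒⁅x⁆⊆p {x = x} x∈p y∈⁅x⁆ = subst (_∈ _) (sym (x∈⁅y⁆⇒x≡y x y∈⁅x⁆)) x∈p

x∈p⇒1≤∣p∣ : x ∈ p → 1 ≤ ∣ p ∣
x∈p⇒1≤∣p∣ {x = x} x∈p = subst (_≤ _) (∣⁅x⁆∣≡1 x) (p⊆q⇒∣p∣≤∣q∣ (x∈p⇒⁅x⁆⊆p x∈p))

2≤∣p∣⇒∃x∈p,x≢y : 2 ≤ ∣ p ∣ → ∀ y → ∃ λ x → x ∈ p × x ≢ y
2≤∣p∣⇒∃x∈p,x≢y {p = p} 2≤∣p∣ y with ⊆⊎⊈ p ⁅ y ⁆
... | inj₂ (x , x∈p , x∉⁅y⁆) = x , x∈p , x∉⁅y⁆⇒x≢y x∉⁅y⁆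
... | inj₁ p⊆⁅y⁆ = contradiction (≤-trans 2≤∣p∣ ∣p∣≤1) λ { (s≤s ()) }
  where
  ∣p∣≤1 : ∣ p ∣ ≤ 1
  ∣p∣≤1 = subst (_ ≤_) (∣⁅x⁆∣≡1 y) (p⊆q⇒∣p∣≤∣q∣ p⊆⁅y⁆)

∣p∣≡1⇒p≡⁅x⁆ : ∣ p ∣ ≡ 1 → ∃ λ x → p ≡ ⁅ x ⁆
∣p∣≡1⇒p≡⁅x⁆ {n} {p} ∣p∣≡1 with nonempty? p
... | no ∄x = contradiction (trans (sym (trans (cong ∣_∣ (Empty-unique ∄x)) (∣⊥∣≡0 n))) ∣p∣≡1) λ ()
... | yes (x , x∈p) with ⊆⊎⊈ p ⁅ x ⁆
...   | inj₁ p⊆⁅x⁆ = x , ⊆-antisym p⊆⁅x⁆ (x∈p⇒⁅x⁆⊆p x∈p)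
...   | inj₂ (y , y∈p , y∉⁅x⁆) = contradiction 2≤1 λ { (s≤s ()) }
  where
  x∈p-y : x ∈ p - y
  x∈p-y = x∈p∧x≢y⇒x∈p-y x∈p λ x≡y → x∉⁅y⁆⇒x≢y y∉⁅x⁆ (sym x≡y)
  2≤1 : 2 ≤ 1
  2≤1 = subst (2 ≤_) ∣p∣≡1 (≤-trans (s≤s (x∈p⇒1≤∣p∣ x∈p-y)) (x∈p⇒∣p-x∣<∣p∣ y∈p))

p∩q[x]≔false∩r≡[p∩q∩r][x]≔false : ∀ (p q r : Subset n) x →
                                  p ∩ (q [ x ]≔ false) ∩ r ≡ (p ∩ q ∩ r) [ x ]≔ false
p∩q[x]≔false∩r≡[p∩q∩r][x]≔false p q r x = begin
  p ∩ (q [ x ]≔ false) ∩ r   ≡⟨ cong (p ∩_) (∩-comm (q [ x ]≔ false) r) ⟩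
  p ∩ r ∩ (q [ x ]≔ false)   ≡⟨ cong (p ∩_) (∩-[]≔false r q x) ⟩
  p ∩ ((r ∩ q) [ x ]≔ false) ≡⟨ cong (λ s → p ∩ (s [ x ]≔ false)) (∩-comm r q) ⟩
  p ∩ ((q ∩ r) [ x ]≔ false) ≡⟨ ∩-[]≔false p (q ∩ r) x ⟩
  (p ∩ q ∩ r) [ x ]≔ false   ∎
  where open ≡-Reasoning

x∈p∩q∩r⁺ : x ∈ p → x ∈ q → x ∈ r → x ∈ p ∩ q ∩ r
x∈p∩q∩r⁺ x∈p x∈q x∈r = x∈p∩q⁺ (x∈p , x∈p∩q⁺ (x∈q , x∈r))

x∈p∩q∩r⁻ : ∀ (p q r : Subset n) → x ∈ p ∩ q ∩ r → x ∈ p × x ∈ q × x ∈ r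
x∈p∩q∩r⁻ p q r x∈p∩q∩r with x∈p∩q⁻ p (q ∩ r) x∈p∩q∩r
... | x∈p , x∈q∩r = x∈p , x∈p∩q⁻ q r x∈q∩r

∣p∩q∩r∣-mono : ∀ (p q r q′ r′ : Subset n) →
               (∀ {x} → x ∈ p → x ∈ q → x ∈ r → x ∈ q′ × x ∈ r′) →
               ∣ p ∩ q ∩ r ∣ ≤ ∣ p ∩ q′ ∩ r′ ∣
∣p∩q∩r∣-mono p q r _ _ f = p⊆q⇒∣p∣≤∣q∣ λ x∈p∩q∩r →
  let x∈p , x∈q , x∈r = x∈p∩q∩r⁻ p q r x∈p∩q∩r
      x∈q′ , x∈r′ = f x∈p x∈q x∈r
  in x∈p∩q∩r⁺ x∈p x∈q′ x∈r′

p[x]≔false⊆q∧x∈q⇒p⊆q : p [ x ]≔ false ⊆ q → x ∈ q → p ⊆ q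
p[x]≔false⊆q∧x∈q⇒p⊆q {p = p} {x = x} p[x]≔false⊆q x∈q {y} y∈p with y ≟ x
... | yes refl = x∈q
... | no y≢x   = p[x]≔false⊆q (x∈p∧x≢y⇒x∈p[y]≔false y∈p y≢x)

module _ (A : ℕ → Subset n) (increasing : ∀ ℓ → A ℓ ⊆ A (suc ℓ)) where

  private
    stable-or-growing : ∀ ℓ → (∃ λ m → A (suc m) ⊆ A m) ⊎ ℓ ≤ ∣ A ℓ ∣
    stable-or-growing zero = inj₂ z≤n
    stable-or-growing (suc ℓ) with stable-or-growing ℓ | ⊆⊎⊈ (A (suc ℓ)) (A ℓ)
    ... | inj₁ stable | _                        = inj₁ stable
    ... | inj₂ _      | inj₁ A₊⊆A                = inj₁ (ℓ , A₊⊆A)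
    ... | inj₂ ℓ≤∣A∣  | inj₂ (x , x∈A₊ , x∉A)     =
      inj₂ (≤-trans (s≤s ℓ≤∣A∣) (p⊂q⇒∣p∣<∣q∣ (increasing ℓ , x , x∈A₊ , x∉A)))

  increasing-chain-stabilises : ∃ λ m → A (suc m) ⊆ A m
  increasing-chain-stabilises with stable-or-growing (suc n)
  ... | inj₁ stable = stable
  ... | inj₂ n<∣A∣  = contradiction (∣p∣≤n (A (suc n))) (<⇒≱ n<∣A∣)

-- Graphs and forests

Adj-sym : (G : Graph n) → Adj G x y → Adj G y x
Adj-sym {x = x} {y = y} G x~y = trans (Graph.sym G y x) x~y

Adj-irrefl : (G : Graph n) → ¬ Adj G x x
Adj-irrefl {x = x} G x~x = contradiction (trans (sym (irrefl G x)) x~x) λ ()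

x∈tabulate⇒fx≡true : ∀ {f : Fin n → Bool} → x ∈ tabulate f → f x ≡ true
x∈tabulate⇒fx≡true {x = x} {f} x∈ = trans (sym (lookup∘tabulate f x)) ([]=⇒lookup x∈)

fx≡true⇒x∈tabulate : ∀ {f : Fin n → Bool} → f x ≡ true → x ∈ tabulate f
fx≡true⇒x∈tabulate {x = x} {f} fx≡true = lookup⇒[]= x (tabulate f) (trans (lookup∘tabulate f x) fx≡true)

∈Γ⇒Adj : (G : Graph n) → x ∈ Γ G u → Adj G u x
∈Γ⇒Adj G = x∈tabulate⇒fx≡true

Adj⇒∈Γ : (G : Graph n) → Adj G u x → x ∈ Γ G u
Adj⇒∈Γ G = fx≡true⇒x∈tabulate

v≁u⇒v∉Γu : (G : Graph n) → adj G v u ≡ false → v ∉ Γ G u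
v≁u⇒v∉Γu G v≁u v∈Γu = contradiction (trans (sym v≁u) (Adj-sym G (∈Γ⇒Adj G v∈Γu))) λ ()

module _ (f : ℕ → Fin n) where

  InjectiveUpTo : ℕ → Set
  InjectiveUpTo m = ∀ {i j} → i ≤ m → j ≤ m → f i ≡ f j → i ≡ j

  private
    Repetition : Set
    Repetition = ∃₂ λ i m → i ≤ m × f i ≡ f (suc m) × InjectiveUpTo m

    search : ∀ m → InjectiveUpTo m ⊎ Repetition
    search zero = inj₁ λ { z≤n z≤n _ → refl }
    search (suc m) with search m
    ... | inj₂ rep = inj₂ rep
    ... | inj₁ inj with any? (λ (k : Fin (suc m)) → f (toℕ k) ≟ f (suc m))
    ...   | yes (k , fk≡fm) = inj₂ (toℕ k , m , ≤-pred (toℕ<n k) , fk≡fm , inj)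
    ...   | no ∄k = inj₁ inj′
      where
      fresh : ∀ {i} → i ≤ m → f i ≢ f (suc m)
      fresh i≤m fi≡fm = ∄k (fromℕ< (s≤s i≤m) , trans (cong f (toℕ-fromℕ< (s≤s i≤m))) fi≡fm)
      inj′ : InjectiveUpTo (suc m)
      inj′ i≤1+m j≤1+m fi≡fj with m≤n⇒m<n∨m≡n i≤1+m | m≤n⇒m<n∨m≡n j≤1+m
      ... | inj₁ (s≤s i≤m) | inj₁ (s≤s j≤m) = inj i≤m j≤m fi≡fj
      ... | inj₁ (s≤s i≤m) | inj₂ refl      = contradiction fi≡fj (fresh i≤m)
      ... | inj₂ refl      | inj₁ (s≤s j≤m) = contradiction (sym fi≡fj) (fresh j≤m)
      ... | inj₂ refl      | inj₂ refl      = refl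

    ¬InjectiveUpTo-n : ¬ InjectiveUpTo n
    ¬InjectiveUpTo-n inj with pigeonhole ≤-refl (λ (k : Fin (suc n)) → f (toℕ k))
    ... | i , j , i<j , fi≡fj =
      <-irrefl (inj (≤-pred (toℕ<n i)) (≤-pred (toℕ<n j)) fi≡fj) i<j

  first-repetition : ∃₂ λ i d → f i ≡ f (suc (i + d)) × InjectiveUpTo (i + d)
  first-repetition with search n
  ... | inj₁ inj = contradiction (λ {i} {j} → inj {i} {j}) ¬InjectiveUpTo-n
  ... | inj₂ (i , m , i≤m , fi≡fm , inj) with m≤n⇒∃[o]m+o≡n i≤m
  ...   | d , refl = i , d , fi≡fm , inj

module _ (G : Graph n) (walk : ℕ → Fin n)
         (adjacent : ∀ i → Adj G (walk i) (walk (suc i)))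
         (non-backtracking : ∀ i → walk (suc (suc i)) ≢ walk i) where

  closed-walk⇒¬Acyclic : ∀ i d → walk i ≡ walk (suc (i + d)) → InjectiveUpTo walk (i + d) →
                         ¬ Acyclic G
  closed-walk⇒¬Acyclic i zero closes _ _ =
    Adj-irrefl G (subst (Adj G (walk i)) (sym (trans closes (cong (walk ∘ suc) (+-identityʳ i))))
                        (adjacent i))
  closed-walk⇒¬Acyclic i (suc zero) closes _ _ =
    non-backtracking i (sym (trans closes (cong (walk ∘ suc) (+-comm i 1))))
  closed-walk⇒¬Acyclic i (suc (suc k)) closes inj acyclic =
    acyclic k cycle (cycle-injective , cycle-steps , cycle-closes)
    where
    cycle : Fin (suc (suc (suc k))) → Fin n
    cycle r = walk (i + toℕ r)

    cycle-injective : Injective _≡_ _≡_ cycle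
    cycle-injective {r} {r′} eq = toℕ-injective (+-cancelˡ-≡ i _ _
      (inj (+-monoʳ-≤ i (≤-pred (toℕ<n r))) (+-monoʳ-≤ i (≤-pred (toℕ<n r′))) eq))

    cycle-steps : ∀ r → Adj G (cycle (inject₁ r)) (cycle (suc r))
    cycle-steps r = subst₂ (Adj G)
      (cong (λ j → walk (i + j)) (sym (toℕ-inject₁ r)))
      (cong walk (sym (+-suc i (toℕ r))))
      (adjacent (i + toℕ r))

    cycle-closes : Adj G (cycle (fromℕ (suc (suc k)))) (cycle zero)
    cycle-closes = subst₂ (Adj G)
      (cong (λ j → walk (i + j)) (sym (toℕ-fromℕ (suc (suc k)))))
      (trans (sym closes) (cong walk (sym (+-identityʳ i))))
      (adjacent (i + suc (suc k)))

module NonBacktrackingWalk (G : Graph n) (U : Subset n)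
                           (branching : ∀ {ℓ} → ℓ ∈ U → 2 ≤ ∣ Γ G ℓ ∩ U ∣) where

  record Arc : Set where
    field
      tail head : Fin n
      head∈U    : head ∈ U
      tail~head : Adj G tail head

  open Arc

  arc-avoiding : ∀ {ℓ} → ℓ ∈ U → Fin n → Arc
  arc-avoiding {ℓ} ℓ∈U p = record
    { tail = ℓ ; head = next ; head∈U = proj₂ (x∈p∩q⁻ (Γ G ℓ) U next∈Γℓ∩U)
    ; tail~head = ∈Γ⇒Adj G (proj₁ (x∈p∩q⁻ (Γ G ℓ) U next∈Γℓ∩U)) }
    where
    next = proj₁ (2≤∣p∣⇒∃x∈p,x≢y (branching ℓ∈U) p)
    next∈Γℓ∩U = proj₁ (proj₂ (2≤∣p∣⇒∃x∈p,x≢y (branching ℓ∈U) p))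

  arcs : u ∈ U → ℕ → Arc
  arcs {u} u∈U zero = arc-avoiding u∈U u
  arcs u∈U (suc i) = arc-avoiding (head∈U (arcs u∈U i)) (tail (arcs u∈U i))

  walk : u ∈ U → ℕ → Fin n
  walk u∈U i = tail (arcs u∈U i)

  adjacent : (u∈U : u ∈ U) → ∀ i → Adj G (walk u∈U i) (walk u∈U (suc i))
  adjacent u∈U i = tail~head (arcs u∈U i)

  non-backtracking : (u∈U : u ∈ U) → ∀ i → walk u∈U (suc (suc i)) ≢ walk u∈U i
  non-backtracking u∈U i =
    proj₂ (proj₂ (2≤∣p∣⇒∃x∈p,x≢y (branching (head∈U (arcs u∈U i))) (tail (arcs u∈U i))))

forest-has-leaf : (G : Graph n) → Acyclic G → u ∈ U → ∃ λ ℓ → ℓ ∈ U × ∣ Γ G ℓ ∩ U ∣ ≤ 1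
forest-has-leaf {U = U} G acyclic u∈U with any? (λ ℓ → ℓ ∈? U ×-dec ∣ Γ G ℓ ∩ U ∣ ≤? 1)
... | yes leaf = leaf
... | no ∄leaf = contradiction acyclic cycle
  where
  open NonBacktrackingWalk G U (λ {ℓ} ℓ∈U → ≰⇒> λ deg≤1 → ∄leaf (ℓ , ℓ∈U , deg≤1))
  cycle : ¬ Acyclic G
  cycle with first-repetition (walk u∈U)
  ... | i , d , closes , inj =
    closed-walk⇒¬Acyclic G (walk u∈U) (adjacent u∈U) (non-backtracking u∈U) i d closes inj

-- Closed sets and target sets

Closed : Graph n → Subset n → (Fin n → ℕ) → Subset n → Set
Closed G U τ C = ∀ {u} → u ∈ U → τ u ≤ ∣ Γ G u ∩ U ∩ C ∣ → u ∈ C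

Generates : Graph n → Subset n → (Fin n → ℕ) → Subset n → Set
Generates {n} G U τ X =
  (C : Subset n) → (∀ {x} → x ∈ X → x ∈ U → x ∈ C) → Closed G U τ C → U ⊆ C

Generates-cong : (∀ {u} → u ∈ U → τ u ≡ τ′ u) → Generates G U τ X → Generates G U τ′ X
Generates-cong τ≗τ′ gen C X⊆C closed =
  gen C X⊆C λ u∈U τu≤ → closed u∈U (subst (_≤ _) (τ≗τ′ u∈U) τu≤)

S⊆Active : ∀ ℓ → S ⊆ Active G τ S ℓ
S⊆Active zero    = id
S⊆Active (suc ℓ) = p⊆p∪q _ ∘ S⊆Active ℓ

Active⊆Closed : Closed G ⊤ τ C → S ⊆ C → ∀ ℓ → Active G τ S ℓ ⊆ C
Active⊆Closed closed S⊆C zero = S⊆C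
Active⊆Closed {G = G} {τ = τ} {C = C} {S = S} closed S⊆C (suc ℓ) {x} x∈A
  with x∈p∪q⁻ (Active G τ S ℓ) _ x∈A
... | inj₁ x∈Aℓ     = Active⊆Closed closed S⊆C ℓ x∈Aℓ
... | inj₂ x∈newest = closed ∈⊤ (≤-trans threshold-met
  (p⊆q⇒∣p∣≤∣q∣ λ y∈Γx∩Aℓ →
    let y∈Γx , y∈Aℓ = x∈p∩q⁻ (Γ G x) (Active G τ S ℓ) y∈Γx∩Aℓ in
    x∈p∩q∩r⁺ y∈Γx ∈⊤ (Active⊆Closed closed S⊆C ℓ y∈Aℓ)))
  where
  threshold-met : τ x ≤ ∣ Γ G x ∩ Active G τ S ℓ ∣
  threshold-met = toWitness (Equivalence.from T-≡ (x∈tabulate⇒fx≡true x∈newest))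

IsTargetSet⇒Generates : IsTargetSet G τ S → Generates G ⊤ τ S
IsTargetSet⇒Generates (ℓ , Aℓ≡⊤) C S⊆C closed x∈⊤ =
  Active⊆Closed closed (λ x∈S → S⊆C x∈S ∈⊤) ℓ (subst (_ ∈_) (sym Aℓ≡⊤) x∈⊤)

Generates⇒IsTargetSet : Generates G ⊤ τ S → IsTargetSet G τ S
Generates⇒IsTargetSet {G = G} {τ = τ} {S = S} gen
  with increasing-chain-stabilises (Active G τ S) (λ ℓ → p⊆p∪q _)
... | m , stable = m , ⊆-antisym ⊆⊤ (gen (Active G τ S m) (λ x∈S _ → S⊆Active m x∈S) closed)
  where
  closed : Closed G ⊤ τ (Active G τ S m)
  closed {u} _ bound = stable (x∈p∪q⁺ (inj₂ (fx≡true⇒x∈tabulate (Equivalence.to T-≡ (fromWitness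
    (subst (λ A → τ u ≤ ∣ Γ G u ∩ A ∣) (∩-identityˡ _) bound))))))

-- Removing a vertex from the residual instance

lowerAround : Graph n → Fin n → (Fin n → ℕ) → Fin n → ℕ
lowerAround G v τ u = if adj G v u then τ u ∸ 1 else τ u

Closed-restrict : v ∈ U → v ∈ C → Closed G U τ C →
                Closed G (U [ v ]≔ false) (lowerAround G v τ) C
Closed-restrict {v = v} {U = U} {C = C} {G = G} {τ = τ} v∈U v∈C closed {u} u∈U′ bound
  with adj G v u in v~u
... | true  = closed u∈U (begin
  τ u                                      ≤⟨ m≤n+m∸n (τ u) 1 ⟩
  suc (τ u ∸ 1)                            ≤⟨ s≤s bound ⟩
  suc ∣ Γ G u ∩ (U [ v ]≔ false) ∩ C ∣
    ≡⟨ cong (suc ∘ ∣_∣) (p∩q[x]≔false∩r≡[p∩q∩r][x]≔false (Γ G u) U C v) ⟩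
  suc ∣ (Γ G u ∩ U ∩ C) [ v ]≔ false ∣     ≡⟨ x∈p⇒1+∣p[x]≔false∣≡∣p∣ _ v v∈N ⟩
  ∣ Γ G u ∩ U ∩ C ∣                        ∎)
  where
  open ≤-Reasoning
  u∈U = p[x]≔false⊆p U v u∈U′
  v∈N = x∈p∩q∩r⁺ (Adj⇒∈Γ G (Adj-sym G v~u)) v∈U v∈C
... | false = closed (p[x]≔false⊆p U v u∈U′)
  (≤-trans bound (∣p∩q∩r∣-mono (Γ G u) (U [ v ]≔ false) C U C
    λ _ x∈U′ x∈C → p[x]≔false⊆p U v x∈U′ , x∈C))

lift-activated : v ∈ U → v ∈ X ⊎ τ v ≡ 0 →
                 Generates G (U [ v ]≔ false) (lowerAround G v τ) X → Generates G U τ X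
lift-activated {v = v} {U = U} {G = G} v∈U seeded gen C X⊆C closed =
  p[x]≔false⊆q∧x∈q⇒p⊆q
    (gen C (λ x∈X x∈U′ → X⊆C x∈X (p[x]≔false⊆p U v x∈U′)) (Closed-restrict {G = G} v∈U v∈C closed))
    v∈C
  where
  v∈C : v ∈ C
  v∈C = [ (λ v∈X → X⊆C v∈X v∈U) , (λ τv≡0 → closed v∈U (subst (_≤ _) (sym τv≡0) z≤n)) ] seeded

lift-postponed : v ∈ U → τ v ≤ ∣ Γ G v ∩ U ∣ →
                 Generates G (U [ v ]≔ false) τ X → Generates G U τ X
lift-postponed {v = v} {U = U} {G = G} v∈U τv≤deg gen C X⊆C closed =
  p[x]≔false⊆q∧x∈q⇒p⊆q U′⊆C v∈C
  where
  U′⊆C : U [ v ]≔ false ⊆ C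
  U′⊆C = gen C (λ x∈X x∈U′ → X⊆C x∈X (p[x]≔false⊆p U v x∈U′)) λ {u} u∈U′ bound →
    closed (p[x]≔false⊆p U v u∈U′)
      (≤-trans bound (∣p∩q∩r∣-mono (Γ G u) (U [ v ]≔ false) C U C
        λ _ x∈U′ x∈C → p[x]≔false⊆p U v x∈U′ , x∈C))
  nbrs⊆C : Γ G v ∩ U ⊆ Γ G v ∩ U ∩ C
  nbrs⊆C {x} x∈Γv∩U with x∈p∩q⁻ (Γ G v) U x∈Γv∩U
  ... | x∈Γv , x∈U = x∈p∩q∩r⁺ x∈Γv x∈U (U′⊆C (x∈p∧x≢y⇒x∈p[y]≔false x∈U x≢v))
    where
    x≢v : x ≢ v
    x≢v refl = Adj-irrefl G (∈Γ⇒Adj G x∈Γv)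
  v∈C : v ∈ C
  v∈C = closed v∈U (≤-trans τv≤deg (p⊆q⇒∣p∣≤∣q∣ nbrs⊆C))

Closed-extend : Closed G (U [ v ]≔ false) (lowerAround G v τ) C → Closed G U τ (C [ v ]≔ true)
Closed-extend {G = G} {U = U} {v = v} {τ = τ} {C = C} closed {u} u∈U bound with u ≟ v
... | yes refl = []≔-updates C u
... | no u≢v   = x∈p⇒x∈p[y]≔true v (closed (x∈p∧x≢y⇒x∈p[y]≔false u∈U u≢v) lowered)
  where
  nbrs⊆ : Γ G u ∩ U ∩ (C [ v ]≔ true) ⊆ (Γ G u ∩ (U [ v ]≔ false) ∩ C) [ v ]≔ true
  nbrs⊆ {x} x∈N with x ≟ v | x∈p∩q∩r⁻ (Γ G u) U (C [ v ]≔ true) x∈N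
  ... | yes refl | _                 = []≔-updates _ v
  ... | no x≢v   | x∈Γu , x∈U , x∈C⁺ = x∈p⇒x∈p[y]≔true v
    (x∈p∩q∩r⁺ x∈Γu (x∈p∧x≢y⇒x∈p[y]≔false x∈U x≢v) (x∈p[y]≔true∧x≢y⇒x∈p x∈C⁺ x≢v))
  lowered : lowerAround G v τ u ≤ ∣ Γ G u ∩ (U [ v ]≔ false) ∩ C ∣
  lowered with adj G v u in v~u
  ... | true  = ∸-monoˡ-≤ 1 (≤-trans bound (≤-trans (p⊆q⇒∣p∣≤∣q∣ nbrs⊆)
                  (∣p[x]≔true∣≤1+∣p∣ (Γ G u ∩ (U [ v ]≔ false) ∩ C) v)))
  ... | false = ≤-trans bound (∣p∩q∩r∣-mono (Γ G u) U (C [ v ]≔ true) (U [ v ]≔ false) C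
    λ x∈Γu x∈U x∈C⁺ → let x≢v = λ { refl → v≁u⇒v∉Γu G v~u x∈Γu } in
      x∈p∧x≢y⇒x∈p[y]≔false x∈U x≢v , x∈p[y]≔true∧x≢y⇒x∈p x∈C⁺ x≢v)

restrict-activated : (∀ {x} → x ∈ X → x ≢ v → x ∈ X′) →
                     Generates G U τ X → Generates G (U [ v ]≔ false) (lowerAround G v τ) X′
restrict-activated {X = X} {v = v} {X′ = X′} {G = G} {U = U} X-v⊆X′ gen C X′⊆C closed {u} u∈U′ =
  x∈p[y]≔true∧x≢y⇒x∈p
    (gen (C [ v ]≔ true) X⊆C⁺ (Closed-extend {G = G} closed) (p[x]≔false⊆p U v u∈U′))
    (x∈p[y]≔false⇒x≢y u∈U′)
  where
  X⊆C⁺ : ∀ {x} → x ∈ X → x ∈ U → x ∈ C [ v ]≔ true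
  X⊆C⁺ {x} x∈X x∈U with x ≟ v
  ... | yes refl = []≔-updates C v
  ... | no x≢v   = x∈p⇒x∈p[y]≔true v (X′⊆C (X-v⊆X′ x∈X x≢v) (x∈p∧x≢y⇒x∈p[y]≔false x∈U x≢v))

seed-required : v ∈ U → ∣ Γ G v ∩ U ∣ < τ v → Generates G U τ X → v ∈ X
seed-required {v = v} {U = U} {G = G} {τ = τ} {X = X} v∈U ∣Γv∩U∣<τv gen with v ∈? X
... | yes v∈X = v∈X
... | no  v∉X = contradiction (gen (U [ v ]≔ false) X⊆U′ closed v∈U) (x∉p[x]≔false U v)
  where
  X⊆U′ : ∀ {x} → x ∈ X → x ∈ U → x ∈ U [ v ]≔ false
  X⊆U′ x∈X x∈U = x∈p∧x≢y⇒x∈p[y]≔false x∈U λ { refl → v∉X x∈X }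
  closed : Closed G U τ (U [ v ]≔ false)
  closed {u} u∈U bound with u ≟ v
  ... | no u≢v   = x∈p∧x≢y⇒x∈p[y]≔false u∈U u≢v
  ... | yes refl = contradiction (≤-trans bound ∣Γv∩U∩U′∣≤∣Γv∩U∣) (<⇒≱ ∣Γv∩U∣<τv)
    where
    ∣Γv∩U∩U′∣≤∣Γv∩U∣ : ∣ Γ G v ∩ U ∩ (U [ v ]≔ false) ∣ ≤ ∣ Γ G v ∩ U ∣
    ∣Γv∩U∩U′∣≤∣Γv∩U∣ = p⊆q⇒∣p∣≤∣q∣ λ x∈N →
      let x∈Γv , x∈U , _ = x∈p∩q∩r⁻ (Γ G v) U (U [ v ]≔ false) x∈N in x∈p∩q⁺ (x∈Γv , x∈U)

leaf-neighbour : (G : Graph n) → Γ G v ∩ U ≡ ⁅ w ⁆ → x ∈ U → Adj G v x → x ≡ w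
leaf-neighbour {w = w} G leaf x∈U v~x = x∈⁅y⁆⇒x≡y w (subst (_ ∈_) leaf (x∈p∩q⁺ (Adj⇒∈Γ G v~x , x∈U)))

Closed-extend-leaf : Γ G v ∩ U ≡ ⁅ w ⁆ → w ∈ C →
                     Closed G (U [ v ]≔ false) τ C → Closed G U τ (C [ v ]≔ true)
Closed-extend-leaf {G = G} {v = v} {U = U} {w = w} {C = C} leaf w∈C closed {u} u∈U bound
  with u ≟ v | u ≟ w
... | yes refl | _        = []≔-updates C u
... | no u≢v   | yes refl = x∈p⇒x∈p[y]≔true v w∈C
... | no u≢v   | no u≢w   = x∈p⇒x∈p[y]≔true v (closed (x∈p∧x≢y⇒x∈p[y]≔false u∈U u≢v)
  (≤-trans bound (∣p∩q∩r∣-mono (Γ G u) U (C [ v ]≔ true) (U [ v ]≔ false) C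
    λ x∈Γu x∈U x∈C⁺ →
      let x≢v = λ { refl → u≢w (leaf-neighbour G leaf u∈U (Adj-sym G (∈Γ⇒Adj G x∈Γu))) } in
      x∈p∧x≢y⇒x∈p[y]≔false x∈U x≢v , x∈p[y]≔true∧x≢y⇒x∈p x∈C⁺ x≢v)))

Closed-extend-inactive-leaf : Γ G v ∩ U ≡ ⁅ w ⁆ → w ∉ C → 1 ≤ τ v →
                     Closed G (U [ v ]≔ false) τ C → Closed G U τ (C [ v ]≔ false)
Closed-extend-inactive-leaf {n} {G = G} {v = v} {U = U} {w = w} {C = C} leaf w∉C 1≤τv closed {u} u∈U bound
  with u ≟ v
... | yes refl = contradiction (≤-trans 1≤τv bound) (subst (1 ≰_) (sym no-active-nbrs) λ ())
  where
  no-active-nbrs : ∣ Γ G v ∩ U ∩ (C [ v ]≔ false) ∣ ≡ 0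
  no-active-nbrs = trans (cong ∣_∣ (Empty-unique λ (x , x∈N) →
    let x∈Γv , x∈U , x∈C⁻ = x∈p∩q∩r⁻ (Γ G v) U (C [ v ]≔ false) x∈N in
    w∉C (subst (_∈ C) (leaf-neighbour G leaf x∈U (∈Γ⇒Adj G x∈Γv)) (p[x]≔false⊆p C v x∈C⁻)))) (∣⊥∣≡0 n)
... | no u≢v = x∈p∧x≢y⇒x∈p[y]≔false (closed (x∈p∧x≢y⇒x∈p[y]≔false u∈U u≢v)
  (≤-trans bound (∣p∩q∩r∣-mono (Γ G u) U (C [ v ]≔ false) (U [ v ]≔ false) C
    λ _ x∈U x∈C⁻ →
      x∈p∧x≢y⇒x∈p[y]≔false x∈U (x∈p[y]≔false⇒x≢y x∈C⁻) , p[x]≔false⊆p C v x∈C⁻))) u≢v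

restrict-leaf : Γ G v ∩ U ≡ ⁅ w ⁆ → 1 ≤ τ v →
                (∀ {x} → x ∈ X → x ≢ v → x ∈ X′) → v ∉ X ⊎ w ∈ X′ →
                Generates G U τ X → Generates G (U [ v ]≔ false) τ X′
restrict-leaf {G = G} {v = v} {U = U} {w = w} {τ = τ} {X = X} {X′ = X′} leaf 1≤τv X-v⊆X′ v∉X⊎w∈X′ gen
  C X′⊆C closed {u} u∈U′ with w ∈? C | v∉X⊎w∈X′
... | yes w∈C | _ = x∈p[y]≔true∧x≢y⇒x∈p
  (gen (C [ v ]≔ true) X⊆C⁺ (Closed-extend-leaf {G = G} leaf w∈C closed) (p[x]≔false⊆p U v u∈U′))
  (x∈p[y]≔false⇒x≢y u∈U′)
  where
  X⊆C⁺ : ∀ {x} → x ∈ X → x ∈ U → x ∈ C [ v ]≔ true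
  X⊆C⁺ {x} x∈X x∈U with x ≟ v
  ... | yes refl = []≔-updates C v
  ... | no x≢v   = x∈p⇒x∈p[y]≔true v (X′⊆C (X-v⊆X′ x∈X x≢v) (x∈p∧x≢y⇒x∈p[y]≔false x∈U x≢v))
... | no w∉C | inj₁ v∉X = p[x]≔false⊆p C v
  (gen (C [ v ]≔ false) X⊆C⁻ (Closed-extend-inactive-leaf {G = G} leaf w∉C 1≤τv closed)
    (p[x]≔false⊆p U v u∈U′))
  where
  X⊆C⁻ : ∀ {x} → x ∈ X → x ∈ U → x ∈ C [ v ]≔ false
  X⊆C⁻ x∈X x∈U = let x≢v = λ { refl → v∉X x∈X } in
    x∈p∧x≢y⇒x∈p[y]≔false (X′⊆C (X-v⊆X′ x∈X x≢v) (x∈p∧x≢y⇒x∈p[y]≔false x∈U x≢v)) x≢v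
... | no w∉C | inj₂ w∈X′ = contradiction (X′⊆C w∈X′ w∈U′) w∉C
  where
  w∈Γv∩U = subst (w ∈_) (sym leaf) (x∈⁅x⁆ w)
  w∈U′ : w ∈ U [ v ]≔ false
  w∈U′ = x∈p∧x≢y⇒x∈p[y]≔false (proj₂ (x∈p∩q⁻ (Γ G v) U w∈Γv∩U))
    λ { refl → Adj-irrefl G (∈Γ⇒Adj G (proj₁ (x∈p∩q⁻ (Γ G v) U w∈Γv∩U))) }

-- Algorithm TSS

record Faithful (G : Graph n) (st : State n) : Set where
  field
    N≡Γ∩U : u ∈ UU st → NN st u ≡ Γ G u ∩ UU st
    δ≡∣N∣ : u ∈ UU st → δ st u ≡ ∣ NN st u ∣

open Faithful

Faithful-init : (G : Graph n) (t : Fin n → ℕ) → Faithful G (initState G t)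
Faithful-init G t = record { N≡Γ∩U = λ _ → sym (∩-identityʳ _) ; δ≡∣N∣ = λ _ → refl }

δ≡∣Γ∩U∣ : Faithful G st → u ∈ UU st → δ st u ≡ ∣ Γ G u ∩ UU st ∣
δ≡∣Γ∩U∣ F u∈U = trans (δ≡∣N∣ F u∈U) (cong ∣_∣ (N≡Γ∩U F u∈U))

lookup-N≡adj : Faithful G st → v ∈ UU st → u ∈ UU st → lookup (NN st v) u ≡ adj G v u
lookup-N≡adj {G = G} {st = st} {v = v} {u = u} F v∈U u∈U = begin
  lookup (NN st v) u                   ≡⟨ cong (λ N → lookup N u) (N≡Γ∩U F v∈U) ⟩
  lookup (Γ G v ∩ UU st) u             ≡⟨ lookup-zipWith _∧_ u (Γ G v) (UU st) ⟩
  lookup (Γ G v) u ∧ lookup (UU st) u  ≡⟨ cong₂ _∧_ (lookup∘tabulate (adj G v) u) ([]=⇒lookup u∈U) ⟩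
  adj G v u ∧ true                     ≡⟨ ∧-identityʳ (adj G v u) ⟩
  adj G v u                            ∎
  where open ≡-Reasoning

decK≡lowerAround : Faithful G st → v ∈ UU st → u ∈ UU st [ v ]≔ false →
                   decK st v u ≡ lowerAround G v (κ st) u
decK≡lowerAround {st = st} {v = v} {u = u} F v∈U u∈U′ =
  cong (λ b → if b then κ st u ∸ 1 else κ st u) (lookup-N≡adj F v∈U (p[x]≔false⊆p (UU st) v u∈U′))

Faithful-removeV : ∀ {τ′ S′} → Faithful G st → v ∈ UU st → Faithful G (removeV st v τ′ S′)
Faithful-removeV {G = G} {st = st} {v = v} F v∈U = record { N≡Γ∩U = N≡ ; δ≡∣N∣ = δ≡ }
  where
  in-U : u ∈ UU st [ v ]≔ false → u ∈ UU st
  in-U = p[x]≔false⊆p (UU st) v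

  N≡ : u ∈ UU st [ v ]≔ false →
       (if lookup (NN st v) u then NN st u [ v ]≔ false else NN st u) ≡ Γ G u ∩ (UU st [ v ]≔ false)
  N≡ {u} u∈U′ with lookup (NN st v) u | lookup-N≡adj F v∈U (in-U u∈U′)
  ... | true  | _   = trans (cong (_[ v ]≔ false) (N≡Γ∩U F (in-U u∈U′)))
    (sym (∩-[]≔false (Γ G u) (UU st) v))
  ... | false | v≁u = trans (N≡Γ∩U F (in-U u∈U′))
    (sym (x∉p⇒p∩q[x]≔b≡p∩q (Γ G u) (UU st) false (v≁u⇒v∉Γu G (sym v≁u))))

  δ≡ : u ∈ UU st [ v ]≔ false →
       (if lookup (NN st v) u then δ st u ∸ 1 else δ st u)
         ≡ ∣ (if lookup (NN st v) u then NN st u [ v ]≔ false else NN st u) ∣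
  δ≡ {u} u∈U′ with lookup (NN st v) u | lookup-N≡adj F v∈U (in-U u∈U′)
  ... | true  | v~u = begin
    δ st u ∸ 1                ≡⟨ cong (_∸ 1) (δ≡∣N∣ F (in-U u∈U′)) ⟩
    ∣ NN st u ∣ ∸ 1           ≡⟨ cong (_∸ 1) (sym (x∈p⇒1+∣p[x]≔false∣≡∣p∣ (NN st u) v v∈Nu)) ⟩
    ∣ NN st u [ v ]≔ false ∣  ∎
    where
    open ≡-Reasoning
    v∈Nu : v ∈ NN st u
    v∈Nu = subst (v ∈_) (sym (N≡Γ∩U F (in-U u∈U′))) (x∈p∩q⁺ (Adj⇒∈Γ G (Adj-sym G (sym v~u)) , v∈U))
  ... | false | _ = δ≡∣N∣ F (in-U u∈U′)

-- Case 3 compares k/(d(d+1)) with the ratio 1/(1·2) of a leaf, cross-multiplied.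
ratio≥½⇒d≡1 : ∀ {d k} → 1 ≤ k → k ≤ d → 1 * (d * suc d) ≤ k * (1 * 2) → d ≡ 1
ratio≥½⇒d≡1 {zero}      1≤k k≤0 _     = contradiction (≤-trans 1≤k k≤0) λ ()
ratio≥½⇒d≡1 {suc d} {k} _   k≤d bound = cong suc (n≤0⇒n≡0 (≤-pred (≤-pred (*-cancelˡ-≤ (suc d) (begin
  suc d * suc (suc d)        ≡⟨ sym (*-identityˡ _) ⟩
  1 * (suc d * suc (suc d))  ≤⟨ bound ⟩
  k * 2                      ≤⟨ *-monoˡ-≤ 2 k≤d ⟩
  suc d * 2                  ∎)))))
  where open ≤-Reasoning

postponed-is-leaf : (G : Graph n) → Acyclic G → Faithful G st →
  (∀ u → u ∈ UU st → κ st u ≢ 0) → (∀ u → u ∈ UU st → ¬ (δ st u < κ st u)) → v ∈ UU st →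
  (∀ u → u ∈ UU st → κ st u * (δ st v * suc (δ st v)) ≤ κ st v * (δ st u * suc (δ st u))) →
  ∃ λ w → Γ G v ∩ UU st ≡ ⁅ w ⁆
postponed-is-leaf {st = st} {v = v} G acyclic F positive saturated v∈U maximal
  with forest-has-leaf G acyclic v∈U
... | ℓ , ℓ∈U , deg≤1 = ∣p∣≡1⇒p≡⁅x⁆ (trans (sym (δ≡∣Γ∩U∣ F v∈U)) δv≡1)
  where
  1≤κℓ : 1 ≤ κ st ℓ
  1≤κℓ = n≢0⇒n>0 (positive ℓ ℓ∈U)
  κℓ≤δℓ : κ st ℓ ≤ δ st ℓ
  κℓ≤δℓ = ≮⇒≥ (saturated ℓ ℓ∈U)
  δℓ≤1 : δ st ℓ ≤ 1
  δℓ≤1 = subst (_≤ 1) (sym (δ≡∣Γ∩U∣ F ℓ∈U)) deg≤1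
  δv≡1 : δ st v ≡ 1
  δv≡1 = ratio≥½⇒d≡1 (n≢0⇒n>0 (positive v v∈U)) (≮⇒≥ (saturated v v∈U))
    (subst₂ (λ k d → k * (δ st v * suc (δ st v)) ≤ κ st v * (d * suc d))
      (≤-antisym (≤-trans κℓ≤δℓ δℓ≤1) 1≤κℓ) (≤-antisym δℓ≤1 (≤-trans 1≤κℓ κℓ≤δℓ))
      (maximal ℓ ℓ∈U))

runs-generate : Faithful G st → Runs st S → SS st ⊆ S × Generates G (UU st) (κ st) S
runs-generate F (done U≡⊥) = id , λ _ _ _ u∈U → contradiction (subst (_ ∈_) U≡⊥ u∈U) ∉⊥
runs-generate {G = G} F (step (case1 v v∈U κv≡0) run)
  with runs-generate (Faithful-removeV F v∈U) run
... | SS⊆S , gen =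
  SS⊆S , lift-activated {G = G} v∈U (inj₂ κv≡0)
    (Generates-cong {G = G} (decK≡lowerAround F v∈U) gen)
runs-generate {G = G} F (step (case2 v _ v∈U _) run)
  with runs-generate (Faithful-removeV F v∈U) run
... | SS′⊆S , gen =
  SS′⊆S ∘ x∈p⇒x∈p[y]≔true v ,
  lift-activated {G = G} v∈U (inj₁ (SS′⊆S ([]≔-updates _ v)))
    (Generates-cong {G = G} (decK≡lowerAround F v∈U) gen)
runs-generate {G = G} F (step (case3 v _ saturated v∈U _) run)
  with runs-generate (Faithful-removeV F v∈U) run
... | SS⊆S , gen =
  SS⊆S , lift-postponed {G = G} v∈U (subst (_ ≤_) (δ≡∣Γ∩U∣ F v∈U) (≮⇒≥ (saturated v v∈U))) gen

runs-optimal : Acyclic G → Faithful G st → Runs st S →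
               Generates G (UU st) (κ st) X → ∣ S ∣ ≤ ∣ SS st ∣ + ∣ X ∣
runs-optimal _ _ (done _) _ = m≤m+n _ _
runs-optimal {G = G} acyclic F (step (case1 v v∈U _) run) gen =
  runs-optimal acyclic (Faithful-removeV F v∈U) run
    (Generates-cong {G = G} (λ u∈U′ → sym (decK≡lowerAround F v∈U u∈U′))
      (restrict-activated {G = G} (λ x∈X _ → x∈X) gen))
runs-optimal {G = G} {st = st} {X = X} acyclic F (step (case2 v _ v∈U deficient) run) gen =
  ≤-trans (runs-optimal acyclic (Faithful-removeV F v∈U) run gen′)
          (∣p[x]≔true∣+∣q[x]≔false∣≤∣p∣+∣q∣ (SS st) X v v∈X)
  where
  v∈X : v ∈ X
  v∈X = seed-required {G = G} v∈U (subst (_< κ st v) (δ≡∣Γ∩U∣ F v∈U) deficient) gen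
  gen′ : Generates G (UU st [ v ]≔ false) (decK st v) (X [ v ]≔ false)
  gen′ = Generates-cong {G = G} (λ u∈U′ → sym (decK≡lowerAround F v∈U u∈U′))
    (restrict-activated {G = G} x∈p∧x≢y⇒x∈p[y]≔false gen)
runs-optimal {G = G} {st = st} {X = X} acyclic F
  (step (case3 v positive saturated v∈U maximal) run) gen
  with postponed-is-leaf G acyclic F positive saturated v∈U maximal | v ∈? X
... | w , leaf | no v∉X = runs-optimal acyclic (Faithful-removeV F v∈U) run
  (restrict-leaf {G = G} leaf (n≢0⇒n>0 (positive v v∈U)) (λ x∈X _ → x∈X) (inj₁ v∉X) gen)
... | w , leaf | yes v∈X =
  ≤-trans (runs-optimal acyclic (Faithful-removeV F v∈U) run gen′)
          (+-monoʳ-≤ ∣ SS st ∣ (∣p[x]≔false[y]≔true∣≤∣p∣ X v w v∈X))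
  where
  gen′ : Generates G (UU st [ v ]≔ false) (κ st) (X [ v ]≔ false [ w ]≔ true)
  gen′ = restrict-leaf {G = G} leaf (n≢0⇒n>0 (positive v v∈U))
    (λ x∈X x≢v → x∈p⇒x∈p[y]≔true w (x∈p∧x≢y⇒x∈p[y]≔false x∈X x≢v))
    (inj₂ ([]≔-updates _ w)) gen

theorem3 : (n : ℕ) (T : Graph n) → IsTree T → (t : Fin n → ℕ) →
           (S : Subset n) → TSSOutput T t S →
           IsTargetSet T t S × ((S′ : Subset n) → IsTargetSet T t S′ → ∣ S ∣ ≤ ∣ S′ ∣)
theorem3 n T (_ , acyclic) t S run =
  Generates⇒IsTargetSet (proj₂ (runs-generate F₀ run)) ,
  λ S′ S′-target → begin
    ∣ S ∣               ≤⟨ runs-optimal acyclic F₀ run (IsTargetSet⇒Generates S′-target) ⟩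
    ∣ ⊥ {n} ∣ + ∣ S′ ∣  ≡⟨ cong (_+ ∣ S′ ∣) (∣⊥∣≡0 n) ⟩
    ∣ S′ ∣              ∎
  where
  open ≤-Reasoning
  F₀ = Faithful-init T t
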